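{- Let $A$ be a finite alphabet and $X$ a set disjoint from $A$. Then $(\mathbb{B}\times\mathcal{P}_\omega((X+A)^*)^A,\otimes,\oplus,\mathtt{1},\mathtt{0})$, with operations defined below, is an idempotent semiring.
   Context: $\mathbb{B}=\{0,1\}$ is the Boolean semiring; $\mathcal{P}_\omega((X+A)^*)$ is the set of finite sets of words over $X+A$ with union and concatenation; $i(1)=\{\epsilon\}$, $i(0)=\emptyset$; $\{b\}$ for $b\in A$ denotes the singleton one-letter word. Define $\mathtt{0}=(0,\lambda a.\emptyset)$, $\mathtt{1}=(1,\lambda a.\emptyset)$, $(o_1,\delta_1)\oplus(o_2,\delta_2)=(o_1\vee o_2,\lambda a.(\delta_1(a)\cup\delta_2(a)))$, and $(o_1,\delta_1)\otimes(o_2,\delta_2)=\big(o_1\wedge o_2,\ \lambda a.\big(\delta_1(a)\,(i(o_2)\cup\bigcup_{b\in A}\{b\}\delta_2(b))\ \cup\ i(o_1)\,\delta_2(a)\big)\big)$. An idempotent semiring is a semiring in which $k+k=k$. -}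

module Defs where

open import Data.Bool using (Bool; true; false; _∨_; _∧_)
open import Data.Nat using (ℕ)
open import Data.Fin using (Fin)
open import Data.List using (List; []; _∷_; _++_; cartesianProductWith; concatMap; map; allFin)
open import Data.List.Membership.Propositional using (_∈_)
open import Data.Product using (_×_; _,_)
open import Data.Sum using (_⊎_; inj₁; inj₂)
open import Function.Bundles using (_⇔_)
open import Relation.Binary.PropositionalEquality using (_≡_)

-- The finite alphabet A is represented as Fin n; X is an arbitrary type.
-- Disjointness of X and A is built in by using the disjoint sum X ⊎ A.

Word : Set → ℕ → Set
Word X n = List (X ⊎ Fin n)

-- Finite sets of words, represented by lists, compared up to
-- extensional equality (same members).  This is P_ω((X+A)^*).
FinSet : Set → ℕ → Set
FinSet X n = List (Word X n)

_≈ₛ_ : ∀ {X n} → FinSet X n → FinSet X n → Set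
S ≈ₛ T = ∀ w → (w ∈ S) ⇔ (w ∈ T)

∅ : ∀ {X n} → FinSet X n
∅ = []

_∪_ : ∀ {X n} → FinSet X n → FinSet X n → FinSet X n
S ∪ T = S ++ T

_·_ : ∀ {X n} → FinSet X n → FinSet X n → FinSet X n
S · T = cartesianProductWith _++_ S T

i : ∀ {X n} → Bool → FinSet X n
i true  = [] ∷ []
i false = []

letter : ∀ {X n} → Fin n → FinSet X n
letter b = (inj₂ b ∷ []) ∷ []

⋃ : ∀ {X n} → (Fin n → FinSet X n) → FinSet X n
⋃ {n = n} f = concatMap f (allFin n)

Carrier : Set → ℕ → Set
Carrier X n = Bool × (Fin n → FinSet X n)

_≈_ : ∀ {X n} → Carrier X n → Carrier X n → Set
(o₁ , δ₁) ≈ (o₂ , δ₂) = (o₁ ≡ o₂) × (∀ a → δ₁ a ≈ₛ δ₂ a)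

𝟘 : ∀ {X n} → Carrier X n
𝟘 = (false , λ a → ∅)

𝟙 : ∀ {X n} → Carrier X n
𝟙 = (true , λ a → ∅)

_⊕_ : ∀ {X n} → Carrier X n → Carrier X n → Carrier X n
(o₁ , δ₁) ⊕ (o₂ , δ₂) = (o₁ ∨ o₂ , λ a → δ₁ a ∪ δ₂ a)

_⊗_ : ∀ {X n} → Carrier X n → Carrier X n → Carrier X n
(o₁ , δ₁) ⊗ (o₂ , δ₂) =
  (o₁ ∧ o₂ , λ a → (δ₁ a · (i o₂ ∪ ⋃ (λ b → letter b · δ₂ b))) ∪ (i o₁ · δ₂ a))

-- A pair (o , δ) denotes the finite language i(o) ∪ ⋃_b {b} δ(b), and ⊕ and ⊗ are
-- designed so that this map turns them into union and concatenation of languages.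
-- The map is also injective up to ≈: o is recovered by asking whether ε belongs to
-- the language, and δ(b) as the set of words w with b w in the language.  Hence the
-- carrier embeds into the idempotent semiring of finite languages and inherits all
-- of its laws.

module Submission where

open import Defs
open import Data.Nat using (ℕ)
open import Algebra.Structures using (IsIdempotentSemiring; IsMonoid)
open import Algebra.Bundles using (CommutativeMonoid; IdempotentSemiring)
open import Algebra.Bundles.Raw using (RawSemiring)
open import Algebra.Morphism.Structures using (module SemiringMorphisms)
import Algebra.Morphism.MonoidMonomorphism as MonoidMonomorphism
import Algebra.Properties.CommutativeSemigroup as CommutativeSemigroupProperties
open import Data.Bool using (true; false; T; _∨_; _∧_)
open import Data.Empty using (⊥-elim)
open import Data.Fin using (Fin)
open import Data.List using (List; []; _∷_; [_]; _++_; cartesianProductWith; allFin)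
open import Data.List.Properties using (++-assoc; ++-identityʳ)
open import Data.List.Membership.Propositional using (_∈_; find; lose)
open import Data.List.Membership.Propositional.Properties
  using (∈-++⁺ˡ; ∈-++⁺ʳ; ∈-++⁻; ∈-cartesianProductWith⁺; ∈-cartesianProductWith⁻; ∈-concatMap⁺; ∈-concatMap⁻; ∈-allFin)
open import Data.List.Relation.Binary.BagAndSetEquality
  using (set; _∼[_]_; commutativeMonoid; ++-cong; ++-idempotent)
open import Data.List.Relation.Binary.Subset.Propositional using (_⊆_)
open import Data.List.Relation.Binary.Subset.Propositional.Properties using (⊆-refl; xs⊆xs++ys; xs⊆ys++xs)
open import Data.List.Relation.Unary.Any using (here)
open import Data.Product using (_×_; _,_; proj₁; proj₂; ∃₂)
open import Data.Sum using (_⊎_; inj₁; inj₂; [_,_]′)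
open import Function using (_∘_)
open import Function.Bundles using (_⇔_; mk⇔; Equivalence)
open import Function.Properties.Equivalence using () renaming (sym to ⇔-sym; trans to ⇔-trans)
open import Relation.Binary.PropositionalEquality using (_≡_; refl; sym; subst)
import Relation.Binary.Reasoning.Setoid as SetoidReasoning
open import Level using (0ℓ)

module IdempotentSemiringMonomorphism
  {a ℓ₁ b ℓ₂} {R₁ : RawSemiring a ℓ₁} {R₂ : RawSemiring b ℓ₂}
  {⟦_⟧ : RawSemiring.Carrier R₁ → RawSemiring.Carrier R₂}
  (isSemiringMonomorphism : SemiringMorphisms.IsSemiringMonomorphism R₁ R₂ ⟦_⟧)
  where

  open SemiringMorphisms.IsSemiringMonomorphism isSemiringMonomorphism
  open RawSemiring R₁ using () renaming (_≈_ to _≈₁_; _+_ to _+₁_; _*_ to _*₁_; 0# to 0#₁; 1# to 1#₁)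
  open RawSemiring R₂ using () renaming (_≈_ to _≈₂_; _+_ to _+₂_; _*_ to _*₂_; 0# to 0#₂; 1# to 1#₂)
  private
    module Additive = MonoidMonomorphism +-isMonoidMonomorphism
    module Multiplicative = MonoidMonomorphism *-isMonoidMonomorphism

  isIdempotentSemiring : IsIdempotentSemiring _≈₂_ _+₂_ _*₂_ 0#₂ 1#₂ →
                         IsIdempotentSemiring _≈₁_ _+₁_ _*₁_ 0#₁ 1#₁
  isIdempotentSemiring S = record
    { isSemiring = record
      { isSemiringWithoutAnnihilatingZero = record
        { +-isCommutativeMonoid = Additive.isCommutativeMonoid S.+-isCommutativeMonoid
        ; *-cong = *-isMonoid.∙-cong
        ; *-assoc = *-isMonoid.assoc
        ; *-identity = *-isMonoid.identity
        ; distrib = distribˡ , distribʳ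
        }
      ; zero = zeroˡ , zeroʳ
      }
    ; +-idem = Additive.idem S.+-isMagma S.+-idem
    }
    where
    module S = IsIdempotentSemiring S
    module *-isMonoid = IsMonoid (Multiplicative.isMonoid S.*-isMonoid)
    open SetoidReasoning S.setoid

    distribˡ : ∀ x y z → x *₁ (y +₁ z) ≈₁ x *₁ y +₁ x *₁ z
    distribˡ x y z = injective (begin
      ⟦ x *₁ (y +₁ z) ⟧               ≈⟨ *-homo x (y +₁ z) ⟩
      ⟦ x ⟧ *₂ ⟦ y +₁ z ⟧             ≈⟨ S.*-cong S.refl (+-homo y z) ⟩
      ⟦ x ⟧ *₂ (⟦ y ⟧ +₂ ⟦ z ⟧)       ≈⟨ S.distribˡ ⟦ x ⟧ ⟦ y ⟧ ⟦ z ⟧ ⟩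
      ⟦ x ⟧ *₂ ⟦ y ⟧ +₂ ⟦ x ⟧ *₂ ⟦ z ⟧ ≈⟨ S.+-cong (*-homo x y) (*-homo x z) ⟨
      ⟦ x *₁ y ⟧ +₂ ⟦ x *₁ z ⟧         ≈⟨ +-homo (x *₁ y) (x *₁ z) ⟨
      ⟦ x *₁ y +₁ x *₁ z ⟧             ∎)

    distribʳ : ∀ x y z → (y +₁ z) *₁ x ≈₁ y *₁ x +₁ z *₁ x
    distribʳ x y z = injective (begin
      ⟦ (y +₁ z) *₁ x ⟧               ≈⟨ *-homo (y +₁ z) x ⟩
      ⟦ y +₁ z ⟧ *₂ ⟦ x ⟧             ≈⟨ S.*-cong (+-homo y z) S.refl ⟩
      (⟦ y ⟧ +₂ ⟦ z ⟧) *₂ ⟦ x ⟧       ≈⟨ S.distribʳ ⟦ x ⟧ ⟦ y ⟧ ⟦ z ⟧ ⟩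
      ⟦ y ⟧ *₂ ⟦ x ⟧ +₂ ⟦ z ⟧ *₂ ⟦ x ⟧ ≈⟨ S.+-cong (*-homo y x) (*-homo z x) ⟨
      ⟦ y *₁ x ⟧ +₂ ⟦ z *₁ x ⟧         ≈⟨ +-homo (y *₁ x) (z *₁ x) ⟨
      ⟦ y *₁ x +₁ z *₁ x ⟧             ∎)

    zeroˡ : ∀ x → 0#₁ *₁ x ≈₁ 0#₁
    zeroˡ x = injective (begin
      ⟦ 0#₁ *₁ x ⟧      ≈⟨ *-homo 0#₁ x ⟩
      ⟦ 0#₁ ⟧ *₂ ⟦ x ⟧  ≈⟨ S.*-cong 0#-homo S.refl ⟩
      0#₂ *₂ ⟦ x ⟧     ≈⟨ S.zeroˡ ⟦ x ⟧ ⟩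
      0#₂             ≈⟨ 0#-homo ⟨
      ⟦ 0#₁ ⟧          ∎)

    zeroʳ : ∀ x → x *₁ 0#₁ ≈₁ 0#₁
    zeroʳ x = injective (begin
      ⟦ x *₁ 0#₁ ⟧      ≈⟨ *-homo x 0#₁ ⟩
      ⟦ x ⟧ *₂ ⟦ 0#₁ ⟧  ≈⟨ S.*-cong S.refl 0#-homo ⟩
      ⟦ x ⟧ *₂ 0#₂     ≈⟨ S.zeroʳ ⟦ x ⟧ ⟩
      0#₂             ≈⟨ 0#-homo ⟨
      ⟦ 0#₁ ⟧          ∎)

module FiniteLanguage (A : Set) where

  Language : Set
  Language = List (List A)

  infix 4 _≋_
  infixl 7 _⊙_

  _≋_ : Language → Language → Set
  _≋_ = _∼[ set ]_

  _⊙_ : Language → Language → Language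
  _⊙_ = cartesianProductWith _++_

  ≋⇒⊆ : ∀ {S T : Language} → S ≋ T → S ⊆ T
  ≋⇒⊆ S≋T = Equivalence.to S≋T

  ≋⇒⊇ : ∀ {S T : Language} → S ≋ T → T ⊆ S
  ≋⇒⊇ S≋T = Equivalence.from S≋T

  ⊆-antisym : ∀ {S T : Language} → S ⊆ T → T ⊆ S → S ≋ T
  ⊆-antisym S⊆T T⊆S = mk⇔ S⊆T T⊆S

  ++-lub : ∀ {S T U : Language} → S ⊆ U → T ⊆ U → S ++ T ⊆ U
  ++-lub S⊆U T⊆U = [ S⊆U , T⊆U ]′ ∘ ∈-++⁻ _

  ∈-⊙⁺ : ∀ {S T : Language} {u v} → u ∈ S → v ∈ T → u ++ v ∈ S ⊙ T
  ∈-⊙⁺ = ∈-cartesianProductWith⁺ _++_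

  ∈-⊙⁻ : ∀ S T {w} → w ∈ S ⊙ T → ∃₂ λ u v → u ∈ S × v ∈ T × w ≡ u ++ v
  ∈-⊙⁻ = ∈-cartesianProductWith⁻ _++_

  ⊙-mono : ∀ {S S′ T T′ : Language} → S ⊆ S′ → T ⊆ T′ → S ⊙ T ⊆ S′ ⊙ T′
  ⊙-mono S⊆S′ T⊆T′ w∈ST with u , v , u∈S , v∈T , refl ← ∈-⊙⁻ _ _ w∈ST =
    ∈-⊙⁺ (S⊆S′ u∈S) (T⊆T′ v∈T)

  ⊙-cong : ∀ {S S′ T T′ : Language} → S ≋ S′ → T ≋ T′ → S ⊙ T ≋ S′ ⊙ T′
  ⊙-cong S≋S′ T≋T′ =
    ⊆-antisym (⊙-mono (≋⇒⊆ S≋S′) (≋⇒⊆ T≋T′)) (⊙-mono (≋⇒⊇ S≋S′) (≋⇒⊇ T≋T′))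

  ⊙-assoc : ∀ S T U → (S ⊙ T) ⊙ U ≋ S ⊙ (T ⊙ U)
  ⊙-assoc S T U = ⊆-antisym to from
    where
    to : (S ⊙ T) ⊙ U ⊆ S ⊙ (T ⊙ U)
    to w∈ with _ , z , uv∈ST , z∈U , refl ← ∈-⊙⁻ (S ⊙ T) U w∈
          with u , v , u∈S , v∈T , refl ← ∈-⊙⁻ S T uv∈ST =
      subst (_∈ S ⊙ (T ⊙ U)) (sym (++-assoc u v z)) (∈-⊙⁺ u∈S (∈-⊙⁺ v∈T z∈U))
    from : S ⊙ (T ⊙ U) ⊆ (S ⊙ T) ⊙ U
    from w∈ with u , _ , u∈S , vz∈TU , refl ← ∈-⊙⁻ S (T ⊙ U) w∈
            with v , z , v∈T , z∈U , refl ← ∈-⊙⁻ T U vz∈TU =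
      subst (_∈ (S ⊙ T) ⊙ U) (++-assoc u v z) (∈-⊙⁺ (∈-⊙⁺ u∈S v∈T) z∈U)

  ⊙-identityˡ : ∀ S → [ [] ] ⊙ S ≋ S
  ⊙-identityˡ S = ⊆-antisym to (∈-⊙⁺ {S = [ [] ]} (here refl))
    where
    to : [ [] ] ⊙ S ⊆ S
    to w∈ with _ , _ , here refl , v∈S , refl ← ∈-⊙⁻ [ [] ] S w∈ = v∈S

  ⊙-identityʳ : ∀ S → S ⊙ [ [] ] ≋ S
  ⊙-identityʳ S = ⊆-antisym to from
    where
    to : S ⊙ [ [] ] ⊆ S
    to w∈ with u , _ , u∈S , here refl , refl ← ∈-⊙⁻ S [ [] ] w∈ =
      subst (_∈ S) (sym (++-identityʳ u)) u∈S
    from : S ⊆ S ⊙ [ [] ]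
    from {w} w∈S = subst (_∈ S ⊙ [ [] ]) (++-identityʳ w) (∈-⊙⁺ w∈S (here refl))

  ⊙-zeroˡ : ∀ S → [] ⊙ S ≋ []
  ⊙-zeroˡ _ = ⊆-antisym (λ ()) (λ ())

  ⊙-zeroʳ : ∀ S → S ⊙ [] ≋ []
  ⊙-zeroʳ S = ⊆-antisym to (λ ())
    where
    to : S ⊙ [] ⊆ []
    to w∈ with _ , _ , _ , () , _ ← ∈-⊙⁻ S [] w∈

  ⊙-distribˡ-++ : ∀ S T U → S ⊙ (T ++ U) ≋ S ⊙ T ++ S ⊙ U
  ⊙-distribˡ-++ S T U = ⊆-antisym to from
    where
    to : S ⊙ (T ++ U) ⊆ S ⊙ T ++ S ⊙ U
    to w∈ with u , v , u∈S , v∈TU , refl ← ∈-⊙⁻ S (T ++ U) w∈ with ∈-++⁻ T v∈TU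
    ... | inj₁ v∈T = ∈-++⁺ˡ (∈-⊙⁺ u∈S v∈T)
    ... | inj₂ v∈U = ∈-++⁺ʳ (S ⊙ T) (∈-⊙⁺ u∈S v∈U)
    from : S ⊙ T ++ S ⊙ U ⊆ S ⊙ (T ++ U)
    from = ++-lub (⊙-mono {S = S} ⊆-refl (xs⊆xs++ys T U))
                  (⊙-mono {S = S} ⊆-refl (xs⊆ys++xs U T))

  ⊙-distribʳ-++ : ∀ S T U → (T ++ U) ⊙ S ≋ T ⊙ S ++ U ⊙ S
  ⊙-distribʳ-++ S T U = ⊆-antisym to from
    where
    to : (T ++ U) ⊙ S ⊆ T ⊙ S ++ U ⊙ S
    to w∈ with u , v , u∈TU , v∈S , refl ← ∈-⊙⁻ (T ++ U) S w∈ with ∈-++⁻ T u∈TU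
    ... | inj₁ u∈T = ∈-++⁺ˡ (∈-⊙⁺ u∈T v∈S)
    ... | inj₂ u∈U = ∈-++⁺ʳ (T ⊙ S) (∈-⊙⁺ u∈U v∈S)
    from : T ⊙ S ++ U ⊙ S ⊆ (T ++ U) ⊙ S
    from = ++-lub (⊙-mono {T = S} (xs⊆xs++ys T U) ⊆-refl)
                  (⊙-mono {T = S} (xs⊆ys++xs U T) ⊆-refl)

  isIdempotentSemiring : IsIdempotentSemiring _≋_ _++_ _⊙_ [] [ [] ]
  isIdempotentSemiring = record
    { isSemiring = record
      { isSemiringWithoutAnnihilatingZero = record
        { +-isCommutativeMonoid =
            CommutativeMonoid.isCommutativeMonoid (commutativeMonoid set (List A))
        ; *-cong = ⊙-cong
        ; *-assoc = ⊙-assoc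
        ; *-identity = ⊙-identityˡ , ⊙-identityʳ
        ; distrib = ⊙-distribˡ-++ , ⊙-distribʳ-++
        }
      ; zero = ⊙-zeroˡ , ⊙-zeroʳ
      }
    ; +-idem = ++-idempotent
    }

  idempotentSemiring : IdempotentSemiring 0ℓ 0ℓ
  idempotentSemiring = record { isIdempotentSemiring = isIdempotentSemiring }

T-injective : ∀ {o o′} → T o ⇔ T o′ → o ≡ o′
T-injective {false} {false} _     = refl
T-injective {false} {true}  To⇔To′ = ⊥-elim (Equivalence.from To⇔To′ _)
T-injective {true}  {false} To⇔To′ = ⊥-elim (Equivalence.to To⇔To′ _)
T-injective {true}  {true}  _     = refl

module Representation (X : Set) (n : ℕ) where

  open FiniteLanguage (X ⊎ Fin n)
  private
    module L = IdempotentSemiring idempotentSemiring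
    open CommutativeSemigroupProperties L.+-commutativeSemigroup using (x∙yz≈xz∙y; interchange)
    open SetoidReasoning L.setoid

  prefixed : (Fin n → FinSet X n) → FinSet X n
  prefixed δ = ⋃ (λ b → letter b ⊙ δ b)

  ∈-prefixed⁺ : ∀ δ {b v} → v ∈ δ b → inj₂ b ∷ v ∈ prefixed δ
  ∈-prefixed⁺ δ {b} v∈ =
    ∈-concatMap⁺ (λ b → letter b ⊙ δ b) (lose (∈-allFin b) (∈-⊙⁺ {S = letter b} (here refl) v∈))

  ∈-prefixed⁻ : ∀ δ {w} → w ∈ prefixed δ → ∃₂ λ b v → v ∈ δ b × w ≡ inj₂ b ∷ v
  ∈-prefixed⁻ δ w∈
    with b , _ , w∈bδ ← find (∈-concatMap⁻ (λ b → letter b ⊙ δ b) {xs = allFin n} w∈)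
    with _ , v , here refl , v∈ , refl ← ∈-⊙⁻ (letter b) (δ b) w∈bδ = b , v , v∈ , refl

  prefixed-mono : ∀ {δ γ} → (∀ b → δ b ⊆ γ b) → prefixed δ ⊆ prefixed γ
  prefixed-mono {δ} {γ} δ⊆γ w∈ with b , v , v∈ , refl ← ∈-prefixed⁻ δ w∈ =
    ∈-prefixed⁺ γ (δ⊆γ b v∈)

  prefixed-cong : ∀ {δ γ} → (∀ b → δ b ≋ γ b) → prefixed δ ≋ prefixed γ
  prefixed-cong δ≋γ = ⊆-antisym (prefixed-mono (≋⇒⊆ ∘ δ≋γ)) (prefixed-mono (≋⇒⊇ ∘ δ≋γ))

  prefixed-[] : prefixed (λ _ → []) ≋ []
  prefixed-[] = ⊆-antisym to (λ ())
    where
    to : prefixed (λ _ → []) ⊆ []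
    to w∈ with _ , _ , () , _ ← ∈-prefixed⁻ (λ _ → []) w∈

  prefixed-++ : ∀ δ γ → prefixed (λ b → δ b ++ γ b) ≋ prefixed δ ++ prefixed γ
  prefixed-++ δ γ = ⊆-antisym to from
    where
    to : prefixed (λ b → δ b ++ γ b) ⊆ prefixed δ ++ prefixed γ
    to w∈ with b , v , v∈ , refl ← ∈-prefixed⁻ (λ b → δ b ++ γ b) w∈ with ∈-++⁻ (δ b) v∈
    ... | inj₁ v∈δb = ∈-++⁺ˡ (∈-prefixed⁺ δ v∈δb)
    ... | inj₂ v∈γb = ∈-++⁺ʳ (prefixed δ) (∈-prefixed⁺ γ v∈γb)
    from : prefixed δ ++ prefixed γ ⊆ prefixed (λ b → δ b ++ γ b)
    from = ++-lub (prefixed-mono (λ b → xs⊆xs++ys (δ b) (γ b)))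
                  (prefixed-mono (λ b → xs⊆ys++xs (γ b) (δ b)))

  prefixed-⊙ʳ : ∀ δ S → prefixed (λ b → δ b ⊙ S) ≋ prefixed δ ⊙ S
  prefixed-⊙ʳ δ S = ⊆-antisym to from
    where
    to : prefixed (λ b → δ b ⊙ S) ⊆ prefixed δ ⊙ S
    to w∈ with b , _ , v∈ , refl ← ∈-prefixed⁻ (λ b → δ b ⊙ S) w∈
          with u , s , u∈ , s∈ , refl ← ∈-⊙⁻ (δ b) S v∈ = ∈-⊙⁺ (∈-prefixed⁺ δ u∈) s∈
    from : prefixed δ ⊙ S ⊆ prefixed (λ b → δ b ⊙ S)
    from w∈ with _ , s , u∈ , s∈ , refl ← ∈-⊙⁻ (prefixed δ) S w∈
            with b , v , v∈ , refl ← ∈-prefixed⁻ δ u∈ = ∈-prefixed⁺ (λ b → δ b ⊙ S) (∈-⊙⁺ v∈ s∈)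

  prefixed-i⊙ : ∀ o δ → prefixed (λ b → i o ⊙ δ b) ≋ i o ⊙ prefixed δ
  prefixed-i⊙ true  δ = L.trans (prefixed-cong (⊙-identityˡ ∘ δ)) (L.sym (⊙-identityˡ (prefixed δ)))
  prefixed-i⊙ false _ = prefixed-[]

  i-∧ : ∀ o o′ → i (o ∧ o′) ≋ i o ⊙ i o′
  i-∧ true  true  = L.refl
  i-∧ true  false = L.refl
  i-∧ false _     = L.refl

  i-∨ : ∀ o o′ → i (o ∨ o′) ≋ i o ++ i o′
  i-∨ true  true  = L.sym (++-idempotent (i true))
  i-∨ true  false = L.refl
  i-∨ false _     = L.refl

  toLanguage : Carrier X n → FinSet X n
  toLanguage (o , δ) = i o ++ prefixed δ

  toLanguage-cong : ∀ {x y} → x ≈ y → toLanguage x ≋ toLanguage y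
  toLanguage-cong {o , _} (refl , δ≈γ) = ++-cong (L.refl {i o}) (prefixed-cong (λ b → δ≈γ b _))

  toLanguage-⊕ : ∀ x y → toLanguage (x ⊕ y) ≋ toLanguage x ++ toLanguage y
  toLanguage-⊕ (o , δ) (o′ , δ′) = begin
    i (o ∨ o′) ++ prefixed (λ b → δ b ++ δ′ b)  ≈⟨ ++-cong (i-∨ o o′) (prefixed-++ δ δ′) ⟩
    (i o ++ i o′) ++ (prefixed δ ++ prefixed δ′) ≈⟨ interchange (i o) (i o′) (prefixed δ) (prefixed δ′) ⟩
    (i o ++ prefixed δ) ++ (i o′ ++ prefixed δ′) ∎

  toLanguage-⊗ : ∀ x y → toLanguage (x ⊗ y) ≋ toLanguage x ⊙ toLanguage y
  toLanguage-⊗ (o , δ) y@(o′ , δ′) = begin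
    i (o ∧ o′) ++ prefixed (λ b → δ b ⊙ ⟦y⟧ ++ i o ⊙ δ′ b)
      ≈⟨ ++-cong (i-∧ o o′) (prefixed-++ (λ b → δ b ⊙ ⟦y⟧) (λ b → i o ⊙ δ′ b)) ⟩
    i o ⊙ i o′ ++ (prefixed (λ b → δ b ⊙ ⟦y⟧) ++ prefixed (λ b → i o ⊙ δ′ b))
      ≈⟨ ++-cong (L.refl {i o ⊙ i o′}) (++-cong (prefixed-⊙ʳ δ ⟦y⟧) (prefixed-i⊙ o δ′)) ⟩
    i o ⊙ i o′ ++ (prefixed δ ⊙ ⟦y⟧ ++ i o ⊙ prefixed δ′)
      ≈⟨ x∙yz≈xz∙y (i o ⊙ i o′) (prefixed δ ⊙ ⟦y⟧) (i o ⊙ prefixed δ′) ⟩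
    (i o ⊙ i o′ ++ i o ⊙ prefixed δ′) ++ prefixed δ ⊙ ⟦y⟧
      ≈⟨ ++-cong (L.sym (⊙-distribˡ-++ (i o) (i o′) (prefixed δ′))) (L.refl {prefixed δ ⊙ ⟦y⟧}) ⟩
    i o ⊙ ⟦y⟧ ++ prefixed δ ⊙ ⟦y⟧
      ≈⟨ ⊙-distribʳ-++ ⟦y⟧ (i o) (prefixed δ) ⟨
    (i o ++ prefixed δ) ⊙ ⟦y⟧ ∎
    where ⟦y⟧ = toLanguage y

  toLanguage-𝟘 : toLanguage 𝟘 ≋ []
  toLanguage-𝟘 = prefixed-[]

  toLanguage-𝟙 : toLanguage 𝟙 ≋ i true
  toLanguage-𝟙 = L.trans (++-cong (L.refl {i true}) prefixed-[]) (L.+-identityʳ (i true))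

  []∈toLanguage⇔ : ∀ x → [] ∈ toLanguage x ⇔ T (proj₁ x)
  []∈toLanguage⇔ (o , δ) = mk⇔ (to o) (from o)
    where
    to : ∀ o → [] ∈ i o ++ prefixed δ → T o
    to o []∈ with ∈-++⁻ (i o) []∈
    to true  _ | inj₁ _ = _
    to false _ | inj₁ ()
    to o     _ | inj₂ []∈δ with _ , _ , _ , () ← ∈-prefixed⁻ δ []∈δ
    from : ∀ o → T o → [] ∈ i o ++ prefixed δ
    from true _ = here refl

  ∷∈toLanguage⇔ : ∀ x {b w} → inj₂ b ∷ w ∈ toLanguage x ⇔ w ∈ proj₂ x b
  ∷∈toLanguage⇔ (o , δ) = mk⇔ (to o) (∈-++⁺ʳ (i o) ∘ ∈-prefixed⁺ δ)
    where
    to : ∀ o {b w} → inj₂ b ∷ w ∈ i o ++ prefixed δ → w ∈ δ b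
    to o bw∈ with ∈-++⁻ (i o) bw∈
    to true  _ | inj₁ (here ())
    to o     _ | inj₂ bw∈δ with _ , _ , w∈ , refl ← ∈-prefixed⁻ δ bw∈δ = w∈

  toLanguage-injective : ∀ {x y} → toLanguage x ≋ toLanguage y → x ≈ y
  toLanguage-injective {x} {y} x≋y =
    T-injective (⇔-trans (⇔-sym ([]∈toLanguage⇔ x)) (⇔-trans x≋y ([]∈toLanguage⇔ y))) ,
    λ b w → ⇔-trans (⇔-sym (∷∈toLanguage⇔ x)) (⇔-trans x≋y (∷∈toLanguage⇔ y))

  rawSemiring : RawSemiring 0ℓ 0ℓ
  rawSemiring = record { _≈_ = _≈_ {X} {n} ; _+_ = _⊕_ ; _*_ = _⊗_ ; 0# = 𝟘 ; 1# = 𝟙 }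

  toLanguage-isSemiringMonomorphism :
    SemiringMorphisms.IsSemiringMonomorphism rawSemiring L.rawSemiring toLanguage
  toLanguage-isSemiringMonomorphism = record
    { isSemiringHomomorphism = record
      { isNearSemiringHomomorphism = record
        { +-isMonoidHomomorphism = record
          { isMagmaHomomorphism = record
            { isRelHomomorphism = record { cong = toLanguage-cong }
            ; homo = toLanguage-⊕
            }
          ; ε-homo = toLanguage-𝟘
          }
        ; *-homo = toLanguage-⊗
        }
      ; 1#-homo = toLanguage-𝟙
      }
    ; injective = toLanguage-injective
    }

proposition7p1 : (X : Set) (n : ℕ) →
    IsIdempotentSemiring (_≈_ {X} {n}) _⊕_ _⊗_ 𝟘 𝟙
proposition7p1 X n =
  IdempotentSemiringMonomorphism.isIdempotentSemiring
    (Representation.toLanguage-isSemiringMonomorphism X n)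
    (FiniteLanguage.isIdempotentSemiring (X ⊎ Fin n))
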